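{- Let $k\ge 2$, let $\mathcal{F}$ be a finite $w$-set system on a ground set $X$, and let $(S_1,\dots,S_k) \in \mathcal{F}^k$. If $(S_1,\dots,S_k)$ is $n$-good under some balanced coloring $\mathcal{C}$ of $X$, then $(S_1,\dots,S_k)$ is $n$-inflatable.
   Context: A $w$-set system is a family of sets each of size at most $w$. A coloring $\mathcal{C}$ of $X$ is a partition $X = X_1 \sqcup \dots \sqcup X_k$ (elements of $X_i$ have color $i$); it is balanced if all $X_i$ have the same size. Given $\mathcal{C}$ and $(S_1,\dots,S_k)$, a set $T \in \mathcal{F}$ mimics $S_j$ if $S_i \cap T = S_i \cap S_j$ for all $i \ne j$ and $T \setminus S_j \subseteq X_j$. The tuple is $n$-$j$-bad under $\mathcal{C}$ if fewer than $|\mathcal{F}|/n$ sets $T\in\mathcal{F}$ mimic $S_j$; it is $n$-bad if it is $n$-$j$-bad for some $j$, and $n$-good otherwise. The tuple is $n$-inflatable if for each $i$ there is $\mathcal{F}_i \subseteq \mathcal{F}$ with $S_i \in \mathcal{F}_i$, $|\mathcal{F}_i| \ge |\mathcal{F}|/n$, such that $T_i \cap T_j = S_i \cap S_j$ whenever $i \neq j$, $T_i \in \mathcal{F}_i$, $T_j \in \mathcal{F}_j$. -}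

module Defs where

open import Data.Nat using (ℕ; _≤_; _*_)
open import Data.Bool using (Bool)
import Data.Bool.Properties as BoolP
open import Data.Fin using (Fin)
import Data.Fin.Properties as FinP
open import Data.Fin.Subset using (Subset; _∩_; _─_; _⊆_; ∣_∣)
open import Data.Fin.Subset.Properties using (_⊆?_)
open import Data.Vec using (tabulate)
open import Data.Vec.Properties using (≡-dec)
open import Data.List using (List; length; filter)
open import Data.List.Membership.Propositional using (_∈_)
open import Data.List.Relation.Unary.Unique.Propositional using (Unique)
open import Data.Product using (_×_; Σ)
open import Relation.Binary.PropositionalEquality using (_≡_; _≢_)
open import Relation.Nullary using (Dec; yes; no; ¬_; isYes)
open import Relation.Nullary.Decidable using (_×-dec_; ¬?)

-- The ground set X is Fin m; a subset of X is a Subset m.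
-- A finite set system F on X is a duplicate-free list of subsets.
SetSystem : ℕ → Set
SetSystem m = List (Subset m)

IsWSetSystem : {m : ℕ} → ℕ → SetSystem m → Set
IsWSetSystem w F = ∀ {T} → T ∈ F → ∣ T ∣ ≤ w

Coloring : ℕ → ℕ → Set
Coloring m k = Fin m → Fin k

colorClass : {m k : ℕ} → Coloring m k → Fin k → Subset m
colorClass c i = tabulate (λ x → isYes (c x FinP.≟ i))

Balanced : {m k : ℕ} → Coloring m k → Set
Balanced c = ∀ i j → ∣ colorClass c i ∣ ≡ ∣ colorClass c j ∣

_≟ˢ_ : {m : ℕ} → (A B : Subset m) → Dec (A ≡ B)
_≟ˢ_ = ≡-dec BoolP._≟_

Mimics : {m k : ℕ} → Coloring m k → (Fin k → Subset m) → Fin k → Subset m → Set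
Mimics c S j T =
  (∀ i → i ≢ j → S i ∩ T ≡ S i ∩ S j) × (T ─ S j ⊆ colorClass c j)

mimics? : {m k : ℕ} (c : Coloring m k) (S : Fin k → Subset m) (j : Fin k) (T : Subset m) →
          Dec (Mimics c S j T)
mimics? c S j T = FinP.all? decImp ×-dec (T ─ S j ⊆? colorClass c j)
  where
  decImp : ∀ i → Dec (i ≢ j → S i ∩ T ≡ S i ∩ S j)
  decImp i with i FinP.≟ j | (S i ∩ T) ≟ˢ (S i ∩ S j)
  ... | _ | yes e = yes (λ _ → e)
  ... | yes i≡j | no _ = yes (λ i≢j → absurd (i≢j i≡j))
    where open import Data.Empty using () renaming (⊥-elim to absurd)
  ... | no i≢j | no ne = no (λ f → ne (f i≢j))

mimicCount : {m k : ℕ} → Coloring m k → SetSystem m → (Fin k → Subset m) → Fin k → ℕ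
mimicCount c F S j = length (filter (mimics? c S j) F)

-- n-good: for every j, at least |F|/n sets of F mimic S_j
-- (i.e. not fewer than |F|/n; stated as |F| ≤ n * count, avoiding division).
Good : {m k : ℕ} → ℕ → Coloring m k → SetSystem m → (Fin k → Subset m) → Set
Good n c F S = ∀ j → length F ≤ n * mimicCount c F S j

Inflatable : {m k : ℕ} → ℕ → SetSystem m → (Fin k → Subset m) → Set
Inflatable {m} {k} n F S =
  Σ (Fin k → SetSystem m) λ G →
      (∀ i → Unique (G i))
    × (∀ i {T} → T ∈ G i → T ∈ F)
    × (∀ i → S i ∈ G i)
    × (∀ i → length F ≤ n * length (G i))
    × (∀ i j → i ≢ j → ∀ {Ti Tj} → Ti ∈ G i → Tj ∈ G j → Ti ∩ Tj ≡ S i ∩ S j)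

-- If Tᵢ mimics Sᵢ and Tⱼ mimics Sⱼ (i ≠ j), then Tᵢ ∩ Tⱼ = Sᵢ ∩ Sⱼ: on Sᵢ the set
-- Tⱼ agrees with Sⱼ, on Sⱼ the set Tᵢ agrees with Sᵢ, and a point outside both Sᵢ
-- and Sⱼ lying in Tᵢ ∩ Tⱼ would have colour i and colour j at once. So the families
-- 𝓕ᵢ of sets of 𝓕 mimicking Sᵢ witness inflatability; n-goodness is exactly the
-- size bound |𝓕ᵢ| ≥ |𝓕|/n, and Sᵢ ∈ 𝓕ᵢ since every set mimics itself.
module Submission where

open import Defs
open import Data.Nat using (ℕ; _≤_)
open import Data.Bool.Properties using (T-≡)
open import Data.Fin using (Fin)
import Data.Fin.Properties as FinP
open import Data.Fin.Subset using (Subset; _∩_; _─_; _⊆_; _∉_; inside; outside)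
  renaming (_∈_ to _∈ˢ_)
open import Data.Fin.Subset.Properties
  using (_∈?_; ⊆-antisym; x∈p∩q⁺; x∈p∩q⁻; x∈p∧x∉q⇒x∈p─q)
open import Data.Vec using (_∷_; there)
open import Data.Vec.Properties using ([]=⇒lookup; lookup∘tabulate)
open import Data.List using (filter)
open import Data.List.Membership.Propositional using (_∈_)
open import Data.List.Membership.Propositional.Properties using (∈-filter⁺; ∈-filter⁻)
open import Data.List.Relation.Unary.Unique.Propositional using (Unique)
import Data.List.Relation.Unary.Unique.Propositional.Properties as Unique
open import Data.Product using (Σ; _×_; _,_; proj₁; proj₂)
open import Data.Empty using (⊥-elim)
open import Function using (_∘_)
open import Function.Bundles using (Equivalence)
open import Relation.Binary.PropositionalEquality using (_≡_; _≢_; refl; sym; trans; subst)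
open import Relation.Nullary using (yes; no; isYes; contradiction)
open import Relation.Nullary.Decidable using (toWitness)

private
  variable
    m k : ℕ

x∉p─p : (p : Subset m) {x : Fin m} → x ∉ p ─ p
x∉p─p (inside ∷ p) (there x∈) = x∉p─p p x∈
x∉p─p (outside ∷ p) (there x∈) = x∉p─p p x∈

∩≡∩-from-traces : {A B T U P Q : Subset m} →
  A ∩ U ≡ A ∩ B → B ∩ T ≡ B ∩ A →
  T ─ A ⊆ P → U ─ B ⊆ Q → (∀ {x} → x ∈ˢ P → x ∉ Q) →
  T ∩ U ≡ A ∩ B
∩≡∩-from-traces {A = A} {B} {T} {U} A∩U≡A∩B B∩T≡B∩A T─A⊆P U─B⊆Q P#Q =
  ⊆-antisym ⊆-direction ⊇-direction
  where
  ⊆-direction : T ∩ U ⊆ A ∩ B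
  ⊆-direction {x} x∈T∩U with x∈p∩q⁻ T U x∈T∩U | x ∈? A | x ∈? B
  ... | _ , x∈U | yes x∈A | _ = subst (x ∈ˢ_) A∩U≡A∩B (x∈p∩q⁺ (x∈A , x∈U))
  ... | x∈T , _ | no x∉A | yes x∈B =
    contradiction (proj₂ (x∈p∩q⁻ B A (subst (x ∈ˢ_) B∩T≡B∩A (x∈p∩q⁺ (x∈B , x∈T))))) x∉A
  ... | x∈T , x∈U | no x∉A | no x∉B =
    ⊥-elim (P#Q (T─A⊆P (x∈p∧x∉q⇒x∈p─q x∈T x∉A)) (U─B⊆Q (x∈p∧x∉q⇒x∈p─q x∈U x∉B)))

  ⊇-direction : A ∩ B ⊆ T ∩ U
  ⊇-direction {x} x∈A∩B with x∈p∩q⁻ A B x∈A∩B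
  ... | x∈A , x∈B = x∈p∩q⁺
    ( proj₂ (x∈p∩q⁻ B T (subst (x ∈ˢ_) (sym B∩T≡B∩A) (x∈p∩q⁺ (x∈B , x∈A))))
    , proj₂ (x∈p∩q⁻ A U (subst (x ∈ˢ_) (sym A∩U≡A∩B) x∈A∩B)) )

∈-colorClass⇒colour : (c : Coloring m k) {j : Fin k} {x : Fin m} →
  x ∈ˢ colorClass c j → c x ≡ j
∈-colorClass⇒colour c {j} {x} x∈ =
  toWitness (Equivalence.from T-≡
    (trans (sym (lookup∘tabulate (λ y → isYes (c y FinP.≟ j)) x)) ([]=⇒lookup x∈)))

colorClass-disjoint : (c : Coloring m k) {i j : Fin k} → i ≢ j →
  ∀ {x} → x ∈ˢ colorClass c i → x ∉ colorClass c j
colorClass-disjoint c i≢j x∈Xᵢ x∈Xⱼ =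
  i≢j (trans (sym (∈-colorClass⇒colour c x∈Xᵢ)) (∈-colorClass⇒colour c x∈Xⱼ))

mimics-self : (c : Coloring m k) (S : Fin k → Subset m) (i : Fin k) → Mimics c S i (S i)
mimics-self c S i = (λ _ _ → refl) , ⊥-elim ∘ x∉p─p (S i)

mimics-∩ : (c : Coloring m k) (S : Fin k → Subset m) {i j : Fin k} {Tᵢ Tⱼ : Subset m} →
  i ≢ j → Mimics c S i Tᵢ → Mimics c S j Tⱼ → Tᵢ ∩ Tⱼ ≡ S i ∩ S j
mimics-∩ c S {i} {j} i≢j (Sₗ∩Tᵢ , Tᵢ─Sᵢ⊆Xᵢ) (Sₗ∩Tⱼ , Tⱼ─Sⱼ⊆Xⱼ) =
  ∩≡∩-from-traces (Sₗ∩Tⱼ i i≢j) (Sₗ∩Tᵢ j (i≢j ∘ sym))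
    Tᵢ─Sᵢ⊆Xᵢ Tⱼ─Sⱼ⊆Xⱼ (colorClass-disjoint c i≢j)

lemma2p3 : (m k w n : ℕ) → 2 ≤ k → 1 ≤ n →
    (F : SetSystem m) → Unique F → IsWSetSystem w F →
    (S : Fin k → Subset m) → (∀ i → S i ∈ F) →
    (Σ (Coloring m k) λ c → Balanced c × Good n c F S) →
    Inflatable n F S
lemma2p3 m k w n _ _ F F-unique _ S S∈F (c , _ , good) =
    mimickers
  , (λ i → Unique.filter⁺ (mimics? c S i) F-unique)
  , (λ i → proj₁ ∘ ∈-mimickers⁻ i)
  , (λ i → ∈-filter⁺ (mimics? c S i) (S∈F i) (mimics-self c S i))
  , good
  , λ i j i≢j Tᵢ∈ Tⱼ∈ → mimics-∩ c S i≢j (proj₂ (∈-mimickers⁻ i Tᵢ∈)) (proj₂ (∈-mimickers⁻ j Tⱼ∈))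
  where
  mimickers : Fin k → SetSystem m
  mimickers i = filter (mimics? c S i) F

  ∈-mimickers⁻ : ∀ i {T} → T ∈ mimickers i → T ∈ F × Mimics c S i T
  ∈-mimickers⁻ i = ∈-filter⁻ (mimics? c S i) {xs = F}
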